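{- Let $A$ be an $m\times n$ $(0,1)$-matrix, and let $t$ be a positive integer. Let $A'$ be obtained from $A$ by a single interchange. Then \[\rho_t(A)-1\le \rho_t(A')\le \rho_t(A)+1.\]
   Context: For a $(0,1)$-matrix $A$ and positive integer $t$, the $t$-term rank $\rho_t(A)$ is the maximum number of $1$s of $A$ that can be chosen with at most one chosen $1$ in each column and at most $t$ chosen $1$s in each row. An interchange replaces a $2\times 2$ submatrix (in some rows $i_1<i_2$ and columns $j_1<j_2$) equal to $\begin{bmatrix}1&0\\0&1\end{bmatrix}$ by $\begin{bmatrix}0&1\\1&0\end{bmatrix}$, or vice versa. -}

module Defs where

open import Data.Nat using (ℕ; zero; suc; _+_; _≤_)
open import Data.Bool using (Bool; true; false; not; _∧_; _∨_)
open import Data.Fin using (Fin; _<_; _≟_)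
open import Data.Maybe using (Maybe; just; nothing; is-just)
open import Data.Product using (Σ; _×_; _,_)
open import Data.Sum using (_⊎_)
open import Relation.Binary.PropositionalEquality using (_≡_)
open import Relation.Nullary.Decidable using (⌊_⌋)

-- An m × n (0,1)-matrix: entry A i j is true iff it equals 1.
Matrix : ℕ → ℕ → Set
Matrix m n = Fin m → Fin n → Bool

count : ∀ {n} → (Fin n → Bool) → ℕ
count {zero}  p = 0
count {suc n} p = b2n (p Fin.zero) + count {n} (λ k → p (Fin.suc k))
  where
    b2n : Bool → ℕ
    b2n true  = 1
    b2n false = 0

-- A choice of positions with at most one chosen position in each column:
-- column j has its chosen position in row i  iff  sel j ≡ just i.
Choice : ℕ → ℕ → Set
Choice m n = Fin n → Maybe (Fin m)

inRow : ∀ {m} → Maybe (Fin m) → Fin m → Bool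
inRow nothing  i = false
inRow (just k) i = ⌊ k ≟ i ⌋

ValidChoice : ∀ {m n} → ℕ → Matrix m n → Choice m n → Set
ValidChoice {m} {n} t A sel =
  (∀ (j : Fin n) (i : Fin m) → sel j ≡ just i → A i j ≡ true) ×
  (∀ (i : Fin m) → count (λ j → inRow (sel j) i) ≤ t)

size : ∀ {m n} → Choice m n → ℕ
size sel = count (λ j → is-just (sel j))

IsTermRank : ∀ {m n} → ℕ → Matrix m n → ℕ → Set
IsTermRank {m} {n} t A r =
  (Σ (Choice m n) λ sel → ValidChoice t A sel × (size sel ≡ r)) ×
  (∀ (sel : Choice m n) → ValidChoice t A sel → size sel ≤ r)

IsIdentity2 : ∀ {m n} → Matrix m n → Fin m → Fin m → Fin n → Fin n → Set
IsIdentity2 A i₁ i₂ j₁ j₂ =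
  (A i₁ j₁ ≡ true) × (A i₁ j₂ ≡ false) × (A i₂ j₁ ≡ false) × (A i₂ j₂ ≡ true)

IsAntiIdentity2 : ∀ {m n} → Matrix m n → Fin m → Fin m → Fin n → Fin n → Set
IsAntiIdentity2 A i₁ i₂ j₁ j₂ =
  (A i₁ j₁ ≡ false) × (A i₁ j₂ ≡ true) × (A i₂ j₁ ≡ true) × (A i₂ j₂ ≡ false)

InterchangeAt : ∀ {m n} → Matrix m n → Matrix m n →
                Fin m → Fin m → Fin n → Fin n → Set
InterchangeAt {m} {n} A A' i₁ i₂ j₁ j₂ =
  (i₁ < i₂) × (j₁ < j₂) ×
  (IsIdentity2 A i₁ i₂ j₁ j₂ ⊎ IsAntiIdentity2 A i₁ i₂ j₁ j₂) ×
  (∀ (i : Fin m) (j : Fin n) →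
     A' i j ≡ (if' ((⌊ i ≟ i₁ ⌋ ∨ ⌊ i ≟ i₂ ⌋) ∧ (⌊ j ≟ j₁ ⌋ ∨ ⌊ j ≟ j₂ ⌋))
                 (not (A i j)) (A i j)))
  where
    if' : Bool → Bool → Bool → Bool
    if' true  x y = x
    if' false x y = y

Interchange : ∀ {m n} → Matrix m n → Matrix m n → Set
Interchange {m} {n} A A' =
  Σ (Fin m) λ i₁ → Σ (Fin m) λ i₂ → Σ (Fin n) λ j₁ → Σ (Fin n) λ j₂ →
    InterchangeAt A A' i₁ i₂ j₁ j₂

-- An interchange only changes columns j₁ and j₂, and in every row where column j₁
-- loses a 1, column j₂ gains one. So from a valid choice we drop the chosen 1s that
-- disappeared; if the 1 chosen in column j₁ disappeared, its row a has a 1 in column j₂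
-- and we choose that instead, which keeps row a within its bound. Either way at most
-- one chosen 1 is lost, and as the inverse of an interchange is again of this kind,
-- the bound holds in both directions.
module Submission where

open import Defs
open import Data.Nat using (ℕ; zero; suc; _+_; _≤_; z≤n; s≤s)
open import Data.Nat.Properties using (≤-trans; ≤-reflexive; m≤n⇒m≤1+n; +-comm)
open import Data.Bool using (Bool; true; false; not; if_then_else_; _∨_)
open import Data.Bool.Properties using (∨-zeroʳ; ∧-zeroʳ; not-involutive)
open import Data.Fin using (Fin; zero; suc; _≟_)
open import Data.Fin.Properties using (<⇒≢)
open import Data.Maybe using (just; nothing; is-just; _>>=_; when)
open import Data.Product using (Σ; _×_; _,_; proj₁)
open import Data.Sum using (_⊎_; inj₁; inj₂)
open import Data.Vec.Functional using (Vector; tail; updateAt)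
open import Data.Vec.Functional.Properties using (updateAt-updates; updateAt-minimal)
open import Function using (_∘_; const)
open import Relation.Binary.PropositionalEquality
open import Relation.Nullary using (does; yes; no; contradiction)
open import Relation.Nullary.Decidable using (⌊_⌋; isYes≗does; dec-true; dec-false)

private
  variable
    m n t : ℕ

_⊆_ : Vector Bool n → Vector Bool n → Set
q ⊆ p = ∀ j → q j ≡ true → p j ≡ true

_⊆_except_ : Vector Bool n → Vector Bool n → Fin n → Set
q ⊆ p except k = ∀ j → j ≢ k → q j ≡ true → p j ≡ true

_∖_ : Vector Bool n → Fin n → Vector Bool n
(p ∖ k) j = if does (j ≟ k) then false else p j

count-mono : {p q : Vector Bool n} → q ⊆ p → count q ≤ count p
count-mono {zero} _ = z≤n
count-mono {suc n} {p} {q} q⊆p with q zero in q₀ | p zero in p₀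
... | false | false = count-mono (q⊆p ∘ suc)
... | false | true  = m≤n⇒m≤1+n (count-mono (q⊆p ∘ suc))
... | true  | true  = s≤s (count-mono (q⊆p ∘ suc))
... | true  | false = contradiction (trans (sym p₀) (q⊆p zero q₀)) λ ()

count-∖ : {p : Vector Bool n} {k : Fin n} → p k ≡ true → count p ≡ suc (count (p ∖ k))
count-∖ {k = zero}  pk rewrite pk = refl
count-∖ {p = p} {suc k} pk with p zero
... | false = count-∖ {p = tail p} pk
... | true  = cong suc (count-∖ {p = tail p} pk)

count≤suc-count-∖ : {p : Vector Bool n} {k : Fin n} → count p ≤ suc (count (p ∖ k))
count≤suc-count-∖ {p = p} {k} with p k in pk
... | true  = ≤-reflexive (count-∖ {p = p} pk)
... | false = m≤n⇒m≤1+n (count-mono p⊆p∖k)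
  where
  p⊆p∖k : p ⊆ (p ∖ k)
  p⊆p∖k j pj with j ≟ k
  ... | yes refl = contradiction (trans (sym pk) pj) λ ()
  ... | no _     = pj

count-mono-except : {p q : Vector Bool n} {k : Fin n} → q ⊆ p except k →
                    count q ≤ suc (count p)
count-mono-except {p = p} {q} {k} q⊆p =
  ≤-trans (count≤suc-count-∖ {p = q} {k}) (s≤s (count-mono q∖k⊆p))
  where
  q∖k⊆p : (q ∖ k) ⊆ p
  q∖k⊆p j with j ≟ k
  ... | yes _   = λ ()
  ... | no j≢k = q⊆p j j≢k

count-exchange : {p q : Vector Bool n} {k l : Fin n} → q ⊆ p except k →
                 p l ≡ true → q l ≡ false → count q ≤ count p
count-exchange {p = p} {q} {k} {l} q⊆p pl ql =
  ≤-trans (count-mono-except q⊆p∖l) (≤-reflexive (sym (count-∖ {p = p} pl)))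
  where
  q⊆p∖l : q ⊆ (p ∖ l) except k
  q⊆p∖l j j≢k qj with j ≟ l
  ... | yes refl = contradiction (trans (sym ql) qj) λ ()
  ... | no _     = q⊆p j j≢k qj

⊆-except-false : {p q : Vector Bool n} {k : Fin n} → q ⊆ p except k → q k ≡ false → q ⊆ p
⊆-except-false {k = k} q⊆p qk j qj with j ≟ k
... | yes refl = contradiction (trans (sym qk) qj) λ ()
... | no j≢k   = q⊆p j j≢k qj

row : Choice m n → Fin m → Vector Bool n
row sel i j = inRow (sel j) i

chosen : Choice m n → Vector Bool n
chosen sel j = is-just (sel j)

restrict : Matrix m n → Choice m n → Choice m n
restrict B sel j = sel j >>= λ i → when (B i j) i

module _ {B : Matrix m n} {sel : Choice m n} where

  restrict-supported : ∀ {i j} → restrict B sel j ≡ just i → B i j ≡ true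
  restrict-supported {j = j} e with sel j
  ... | just k with B k j in Bkj
  restrict-supported refl | just k | true = Bkj

  restrict-row : ∀ i → row (restrict B sel) i ⊆ row sel i
  restrict-row i j with sel j
  ... | just k with B k j
  ...   | true = λ e → e

  restrict-keeps : ∀ {i j} → sel j ≡ just i → B i j ≡ true → restrict B sel j ≡ just i
  restrict-keeps e Bij rewrite e | Bij = refl

  restrict-valid : ∀ {A} → ValidChoice t A sel → ValidChoice t B (restrict B sel)
  restrict-valid (_ , rows) =
    (λ _ _ → restrict-supported) , λ i → ≤-trans (count-mono (restrict-row i)) (rows i)

  restrict-size : ∀ {k} → (∀ j → j ≢ k → ∀ {i} → sel j ≡ just i → B i j ≡ true) →
                  size sel ≤ suc (size (restrict B sel))
  restrict-size {k} supported = count-mono-except kept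
    where
    kept : chosen sel ⊆ chosen (restrict B sel) except k
    kept j j≢k _ with sel j in e
    ... | just i rewrite supported j j≢k e = refl

  module Relocate {j₁ j₂ : Fin n} (j₁≢j₂ : j₁ ≢ j₂) {a : Fin m}
                  (sel-j₁ : sel j₁ ≡ just a) (Ba₁ : B a j₁ ≡ false) (Ba₂ : B a j₂ ≡ true)
                  (supported : ∀ j → j ≢ j₁ → j ≢ j₂ → ∀ {i} → sel j ≡ just i → B i j ≡ true)
                  where

    relocated : Choice m n
    relocated = updateAt (restrict B sel) j₂ (const (just a))

    relocated-j₂ : relocated j₂ ≡ just a
    relocated-j₂ = updateAt-updates j₂ (restrict B sel)

    relocated-other : ∀ {j} → j ≢ j₂ → relocated j ≡ restrict B sel j
    relocated-other {j} j≢j₂ = updateAt-minimal j j₂ (restrict B sel) j≢j₂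

    relocated-row : ∀ i → row relocated i ⊆ row sel i except j₂
    relocated-row i j j≢j₂ rewrite relocated-other j≢j₂ = restrict-row i j

    relocated-row-bound : ∀ i → count (row relocated i) ≤ count (row sel i)
    relocated-row-bound i with a ≟ i
    ... | yes refl = count-exchange (relocated-row a) sel-a₁ relocated-a₁
      where
      sel-a₁ : row sel a j₁ ≡ true
      sel-a₁ rewrite sel-j₁ = trans (isYes≗does (a ≟ a)) (dec-true (a ≟ a) refl)
      relocated-a₁ : row relocated a j₁ ≡ false
      relocated-a₁ rewrite relocated-other j₁≢j₂ | sel-j₁ | Ba₁ = refl
    ... | no a≢i = count-mono (⊆-except-false (relocated-row i) relocated-i₂)
      where
      relocated-i₂ : row relocated i j₂ ≡ false
      relocated-i₂ rewrite relocated-j₂ = trans (isYes≗does (a ≟ i)) (dec-false (a ≟ i) a≢i)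

    relocated-valid : ∀ {A} → ValidChoice t A sel → ValidChoice t B relocated
    relocated-valid (_ , rows) = supp , λ i → ≤-trans (relocated-row-bound i) (rows i)
      where
      supp : ∀ j i → relocated j ≡ just i → B i j ≡ true
      supp j i e with j ≟ j₂
      ... | yes refl with trans (sym relocated-j₂) e
      ...   | refl = Ba₂
      supp j i e | no j≢j₂ = restrict-supported (trans (sym (relocated-other j≢j₂)) e)

    relocated-size : size sel ≤ suc (size relocated)
    relocated-size = count-mono-except kept
      where
      kept : chosen sel ⊆ chosen relocated except j₁
      kept j j≢j₁ _ with j ≟ j₂
      ... | yes refl rewrite relocated-j₂ = refl
      ... | no j≢j₂ with sel j in e
      ...   | just i rewrite relocated-other j≢j₂
                           | restrict-keeps e (supported j j≢j₁ j≢j₂ e) = refl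

record ColumnShift (B B' : Matrix m n) (j₁ j₂ : Fin n) : Set where
  field
    distinct  : j₁ ≢ j₂
    unchanged : ∀ i j → j ≢ j₁ → j ≢ j₂ → B' i j ≡ B i j
    shifted   : ∀ i → B i j₁ ≡ true → B' i j₁ ≡ false → B' i j₂ ≡ true

module _ {B B' : Matrix m n} {j₁ j₂ : Fin n} (S : ColumnShift B B' j₁ j₂)
         {sel : Choice m n} (v : ValidChoice t B sel) where
  open ColumnShift S

  private
    supported-outside : ∀ j → j ≢ j₁ → j ≢ j₂ → ∀ {i} → sel j ≡ just i → B' i j ≡ true
    supported-outside j j≢j₁ j≢j₂ {i} e = trans (unchanged i j j≢j₁ j≢j₂) (proj₁ v j i e)

    supported-except-j₂ : (∀ {i} → sel j₁ ≡ just i → B' i j₁ ≡ true) →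
                          ∀ j → j ≢ j₂ → ∀ {i} → sel j ≡ just i → B' i j ≡ true
    supported-except-j₂ supported-j₁ j j≢j₂ with j ≟ j₁
    ... | yes refl = supported-j₁
    ... | no j≢j₁  = supported-outside j j≢j₁ j≢j₂

  shift-transfer : Σ (Choice m n) λ sel' → ValidChoice t B' sel' × (size sel ≤ suc (size sel'))
  shift-transfer with sel j₁ in e
  ... | nothing = restrict B' sel , restrict-valid v , restrict-size (supported-except-j₂ absent)
    where
    absent : ∀ {i} → sel j₁ ≡ just i → B' i j₁ ≡ true
    absent e′ with () ← trans (sym e) e′
  ... | just a with B' a j₁ in Ba₁
  ...   | true  = restrict B' sel , restrict-valid v , restrict-size (supported-except-j₂ survives)
    where
    survives : ∀ {i} → sel j₁ ≡ just i → B' i j₁ ≡ true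
    survives e′ with refl ← trans (sym e) e′ = Ba₁
  ...   | false = relocated , relocated-valid v , relocated-size
    where
    open Relocate distinct e Ba₁ (shifted a (proj₁ v j₁ a e) Ba₁) supported-outside

termRank-shift : ∀ {B B' : Matrix m n} {j₁ j₂ r r'} → ColumnShift B B' j₁ j₂ →
                 IsTermRank t B r → IsTermRank t B' r' → r ≤ r' + 1
termRank-shift {r' = r'} S ((sel , v , refl) , _) (_ , maximal) with shift-transfer S v
... | sel' , v' , lost≤1 =
  ≤-trans lost≤1 (≤-trans (s≤s (maximal sel' v')) (≤-reflexive (+-comm 1 r')))

either-true : ∀ {x a b : Fin n} → x ≡ a ⊎ x ≡ b → ⌊ x ≟ a ⌋ ∨ ⌊ x ≟ b ⌋ ≡ true
either-true {x = x} (inj₁ refl) rewrite isYes≗does (x ≟ x) | dec-true (x ≟ x) refl = refl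
either-true {x = x} {a} (inj₂ refl)
  rewrite isYes≗does (x ≟ x) | dec-true (x ≟ x) refl = ∨-zeroʳ ⌊ x ≟ a ⌋

neither-false : ∀ {x a b : Fin n} → x ≢ a → x ≢ b → ⌊ x ≟ a ⌋ ∨ ⌊ x ≟ b ⌋ ≡ false
neither-false {x = x} {a} {b} x≢a x≢b
  rewrite isYes≗does (x ≟ a) | dec-false (x ≟ a) x≢a
        | isYes≗does (x ≟ b) | dec-false (x ≟ b) x≢b = refl

module _ {A A' : Matrix m n} {i₁ i₂ : Fin m} {j₁ j₂ : Fin n} where

  interchange-outside-rows : InterchangeAt A A' i₁ i₂ j₁ j₂ →
                             ∀ {i} j → i ≢ i₁ → i ≢ i₂ → A' i j ≡ A i j
  interchange-outside-rows (_ , _ , _ , entry) {i} j i≢i₁ i≢i₂ with entry i j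
  ... | e rewrite neither-false i≢i₁ i≢i₂ = e

  interchange-outside-columns : InterchangeAt A A' i₁ i₂ j₁ j₂ →
                                ∀ i {j} → j ≢ j₁ → j ≢ j₂ → A' i j ≡ A i j
  interchange-outside-columns (_ , _ , _ , entry) i {j} j≢j₁ j≢j₂ with entry i j
  ... | e rewrite neither-false j≢j₁ j≢j₂ | ∧-zeroʳ (⌊ i ≟ i₁ ⌋ ∨ ⌊ i ≟ i₂ ⌋) = e

  interchange-inside : InterchangeAt A A' i₁ i₂ j₁ j₂ → ∀ {i j} →
                       i ≡ i₁ ⊎ i ≡ i₂ → j ≡ j₁ ⊎ j ≡ j₂ → A' i j ≡ not (A i j)
  interchange-inside (_ , _ , _ , entry) {i} {j} i∈ j∈ with entry i j
  ... | e rewrite either-true i∈ | either-true j∈ = e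

  interchange-changed-row : InterchangeAt A A' i₁ i₂ j₁ j₂ → ∀ {i j} →
                            A' i j ≢ A i j → i ≡ i₁ ⊎ i ≡ i₂
  interchange-changed-row I {i} {j} changed with i ≟ i₁ | i ≟ i₂
  ... | yes i≡i₁ | _        = inj₁ i≡i₁
  ... | no _     | yes i≡i₂ = inj₂ i≡i₂
  ... | no i≢i₁  | no i≢i₂  = contradiction (interchange-outside-rows I j i≢i₁ i≢i₂) changed

  interchange-pattern : InterchangeAt A A' i₁ i₂ j₁ j₂ → ∀ {i} →
                        i ≡ i₁ ⊎ i ≡ i₂ → A i j₂ ≡ not (A i j₁)
  interchange-pattern (_ , _ , inj₁ (a₁₁ , a₁₂ , _ , _) , _) (inj₁ refl) rewrite a₁₁ | a₁₂ = refl
  interchange-pattern (_ , _ , inj₂ (a₁₁ , a₁₂ , _ , _) , _) (inj₁ refl) rewrite a₁₁ | a₁₂ = refl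
  interchange-pattern (_ , _ , inj₁ (_ , _ , a₂₁ , a₂₂) , _) (inj₂ refl) rewrite a₂₁ | a₂₂ = refl
  interchange-pattern (_ , _ , inj₂ (_ , _ , a₂₁ , a₂₂) , _) (inj₂ refl) rewrite a₂₁ | a₂₂ = refl

  interchange-shift : InterchangeAt A A' i₁ i₂ j₁ j₂ → ColumnShift A A' j₁ j₂
  interchange-shift I@(_ , j₁<j₂ , _) = record
    { distinct  = <⇒≢ j₁<j₂
    ; unchanged = λ i _ → interchange-outside-columns I i
    ; shifted   = shifted
    }
    where
    shifted : ∀ i → A i j₁ ≡ true → A' i j₁ ≡ false → A' i j₂ ≡ true
    shifted i A₁ A'₁ = begin
      A' i j₂             ≡⟨ interchange-inside I i∈ (inj₂ refl) ⟩
      not (A i j₂)        ≡⟨ cong not (interchange-pattern I i∈) ⟩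
      not (not (A i j₁))  ≡⟨ not-involutive (A i j₁) ⟩
      A i j₁              ≡⟨ A₁ ⟩
      true                ∎
      where
      open ≡-Reasoning
      i∈ : i ≡ i₁ ⊎ i ≡ i₂
      i∈ = interchange-changed-row I (λ e → contradiction (trans (sym A'₁) (trans e A₁)) λ ())

  interchange-shift⁻¹ : InterchangeAt A A' i₁ i₂ j₁ j₂ → ColumnShift A' A j₁ j₂
  interchange-shift⁻¹ I@(_ , j₁<j₂ , _) = record
    { distinct  = <⇒≢ j₁<j₂
    ; unchanged = λ i _ j≢j₁ j≢j₂ → sym (interchange-outside-columns I i j≢j₁ j≢j₂)
    ; shifted   = shifted
    }
    where
    shifted : ∀ i → A' i j₁ ≡ true → A i j₁ ≡ false → A i j₂ ≡ true
    shifted i A'₁ A₁ = trans (interchange-pattern I i∈) (cong not A₁)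
      where
      i∈ : i ≡ i₁ ⊎ i ≡ i₂
      i∈ = interchange-changed-row I (λ e → contradiction (trans (sym A₁) (trans (sym e) A'₁)) λ ())

-- The bound does not need t ≥ 1.
proposition2p4 : ∀ {m n} (A A' : Matrix m n) (t : ℕ) → 1 ≤ t →
    Interchange A A' → ∀ (r r' : ℕ) → IsTermRank t A r → IsTermRank t A' r' →
    (r ≤ r' + 1) × (r' ≤ r + 1)
proposition2p4 A A' t _ (_ , _ , _ , _ , I) r r' ρ ρ' =
  termRank-shift (interchange-shift I) ρ ρ' , termRank-shift (interchange-shift⁻¹ I) ρ' ρ
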